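{- Let $k\ge2$. For every integer $m\ge1$, \[d_0(m,k)=\begin{cases} n, & \text{if } m=\frac{k^n-1}{k-1} \text{ for some integer } n\ge1,\\ \nu_k\big((k-1)m+1\big)+1, & \text{otherwise.}\end{cases}\]
   Context: Fix an integer $k\ge 2$. Let $T_k$ be the infinite rooted $k$-ary tree (every vertex has exactly $k$ children) with one additional self-loop at the root, so every vertex has degree $k+1$. Chip-firing: a vertex with at least $k+1$ chips may fire, sending one chip along each incident edge (a non-root vertex sends one chip to its parent and one to each of its $k$ children; the root sends one chip to each of its $k$ children and one chip to itself along the self-loop). Starting with $N\ge 0$ chips at the root and none elsewhere, vertices fire until no vertex can fire; this terminates, and the number of times each vertex fires does not depend on the order of firings. $f_0(N,k)$ denotes the number of times the root fires (so $f_0(0,k)=0$). Define $g_0(m,k)=f_0(mk,k)$ and $d_0(m,k)=g_0(m+1,k)-g_0(m,k)$. For a positive integer $x$, $\nu_k(x)$ is the largest integer $e\ge0$ with $k^e\mid x$ (the number of trailing zeros of $x$ in base $k$), also for composite $k$. -}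

module Defs where

open import Data.Nat using (ℕ; zero; suc; _+_; _*_; _∸_; _^_; _≤_; _<_)
open import Data.Nat.Divisibility using (_∣_)
open import Data.Fin using (Fin)
open import Data.List using (List; []; _∷_)
open import Data.List.Properties using (≡-dec)
open import Data.Fin.Properties using () renaming (_≟_ to _≟F_)
open import Data.Product using (Σ; _×_)
open import Relation.Nullary using (Dec; yes; no)
open import Relation.Binary.PropositionalEquality using (_≡_)

-- Vertices of the infinite rooted k-ary tree T_k: a vertex is the path from
-- the root, stored most-recent-step first.  The root is [];
-- the children of v are  i ∷ v  (i : Fin k); the parent of  i ∷ v  is v.
Vertex : ℕ → Set
Vertex k = List (Fin k)

root : {k : ℕ} → Vertex k
root = []

_≟V_ : {k : ℕ} → (v w : Vertex k) → Dec (v ≡ w)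
_≟V_ = ≡-dec _≟F_

Config : ℕ → Set
Config k = Vertex k → ℕ

initial : (k N : ℕ) → Config k
initial k N [] = N
initial k N (_ ∷ _) = 0

isChildOf : {k : ℕ} → Vertex k → Vertex k → ℕ
isChildOf [] v = 0
isChildOf (_ ∷ p) v with p ≟V v
... | yes _ = 1
... | no _ = 0

selfLoop : {k : ℕ} → Vertex k → ℕ
selfLoop [] = 1
selfLoop (_ ∷ _) = 0

-- fire vertex v: v loses k+1 chips (one along each of its k+1 incident edges);
-- each child of v gains one chip, the parent of v (if v ≠ root) gains one chip,
-- and if v is the root it gets one chip back along the self-loop.
fire : (k : ℕ) → Vertex k → Config k → Config k
fire k v c w with w ≟V v
... | yes _ = (c w ∸ suc k) + selfLoop v
... | no _ = c w + isChildOf w v + isChildOf v w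

data Run (k : ℕ) : Config k → List (Vertex k) → Config k → Set where
  done : ∀ {c} → Run k c [] c
  step : ∀ {c v vs c'} → suc k ≤ c v → Run k (fire k v c) vs c' → Run k c (v ∷ vs) c'

Stable : (k : ℕ) → Config k → Set
Stable k c = ∀ v → c v < suc k

Stabilizing : (k : ℕ) → Config k → List (Vertex k) → Set
Stabilizing k c vs = Σ (Config k) λ c' → Run k c vs c' × Stable k c'

rootFires : {k : ℕ} → List (Vertex k) → ℕ
rootFires [] = 0
rootFires ([] ∷ vs) = suc (rootFires vs)
rootFires ((_ ∷ _) ∷ vs) = rootFires vs

IsNu : ℕ → ℕ → ℕ → Set
IsNu k x e = (k ^ e ∣ x) × (∀ e' → k ^ e' ∣ x → e' ≤ e)

{-# OPTIONS --safe #-}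

-- Chip-firing is abelian: by the least action principle every complete legal firing sequence fires
-- each vertex equally often, so it suffices to exhibit one stabilizing sequence. Firing whole levels
-- of the tree keeps a configuration constant on levels, described by its profile (chips per vertex
-- at each depth). From mk chips one reaches the stable profile k, d₁, d₂, …, where d₁d₂… are the
-- digits of m − 1 in bijective base k (digits 1, …, k), least significant first. Adding k chips and
-- firing the root once adds a chip at depth 1; then each of the lowest digits equal to k overflows
-- into a wave firing every level from its depth up to the root once, until a digit below k absorbs
-- the carry. Hence d₀(m, k) = 1 + (number of carries from m − 1 to m). Finally (k − 1)m + 1 gains
-- exactly one factor k per carry: it is k^n when all digits are k, i.e. m = (k^n − 1)/(k − 1), and
-- otherwise the number of carries is ν_k((k − 1)m + 1).

module Submission where

open import Defs
open import Algebra.Properties.CommutativeSemigroup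
  using (interchange; xy∙z≈xz∙y)
open import Level using (Level)
open import Data.Bool using (if_then_else_)
open import Data.Fin using (Fin) renaming (zero to fzero; suc to fsuc)
open import Data.Fin.Properties using () renaming (_≟_ to _≟F_)
open import Data.List using (List; []; _∷_; [_]; _++_; map; tabulate; concatMap; length; replicate)
open import Data.List.Properties
  using (map-++; map-cong; map-tabulate; tabulate-cong; ∷-injectiveˡ; ∷-injectiveʳ; ++-assoc; ++-identityʳ)
open import Data.List.Relation.Unary.All as All using (All; []; _∷_)
open import Data.Nat
  using (ℕ; zero; suc; _+_; _*_; _∸_; _^_; _≤_; _<_; z≤n; s≤s; pred; _≟_; _<?_; NonZero; >-nonZero; ≢-nonZero⁻¹)
open import Data.Nat.Divisibility using (_∣_; ∣-trans; ∣⇒≤; ∣m+n∣m⇒∣n; *-cancelˡ-∣; m∣m*n; *-monoʳ-∣; 1∣_)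
open import Data.Nat.ListAction using (sum)
open import Data.Nat.ListAction.Properties using (sum-++)
open import Data.Nat.Properties
open import Data.Nat.Tactic.RingSolver using (solve-∀)
open import Data.Product using (Σ; ∃-syntax; ∃₂; _×_; _,_; proj₂)
open import Function using (_∘_; _⇔_; mk⇔; Equivalence)
open import Relation.Nullary using (¬_; Dec; yes; no; does; contradiction)
open import Relation.Binary.PropositionalEquality
  using (_≡_; _≢_; refl; sym; trans; cong; cong₂; subst; module ≡-Reasoning)

private
  variable
    p q : Level
    P : Set p
    Q : Set q

𝟙[_] : Dec P → ℕ
𝟙[ d ] = if does d then 1 else 0

𝟙-yes : (d : Dec P) → P → 𝟙[ d ] ≡ 1
𝟙-yes (yes _) _ = refl
𝟙-yes (no ¬p) p = contradiction p ¬p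

𝟙-no : (d : Dec P) → ¬ P → 𝟙[ d ] ≡ 0
𝟙-no (yes p) ¬p = contradiction p ¬p
𝟙-no (no _) _ = refl

𝟙≤1 : (d : Dec P) → 𝟙[ d ] ≤ 1
𝟙≤1 (yes _) = ≤-refl
𝟙≤1 (no _) = z≤n

𝟙-sound : (d : Dec P) → 1 ≤ 𝟙[ d ] → P
𝟙-sound (yes p) _ = p

𝟙-cong : (P → Q) → (Q → P) → (d : Dec P) (e : Dec Q) → 𝟙[ d ] ≡ 𝟙[ e ]
𝟙-cong to from (yes p) e = sym (𝟙-yes e (to p))
𝟙-cong to from (no ¬p) e = sym (𝟙-no e (¬p ∘ from))

module _ {a} {A : Set a} where

  sum-map-+ : ∀ (f g : A → ℕ) xs → sum (map (λ x → f x + g x) xs) ≡ sum (map f xs) + sum (map g xs)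
  sum-map-+ f g [] = refl
  sum-map-+ f g (x ∷ xs) = begin
    f x + g x + sum (map (λ x → f x + g x) xs)      ≡⟨ cong (f x + g x +_) (sum-map-+ f g xs) ⟩
    f x + g x + (sum (map f xs) + sum (map g xs))   ≡⟨ interchange +-commutativeSemigroup (f x) (g x) _ _ ⟩
    f x + sum (map f xs) + (g x + sum (map g xs))   ∎
    where open ≡-Reasoning

  sum-map-mono-≤ : ∀ {f g : A → ℕ} → (∀ x → f x ≤ g x) → ∀ xs → sum (map f xs) ≤ sum (map g xs)
  sum-map-mono-≤ f≤g [] = z≤n
  sum-map-mono-≤ f≤g (x ∷ xs) = +-mono-≤ (f≤g x) (sum-map-mono-≤ f≤g xs)

  sum-map-const : ∀ c (xs : List A) → sum (map (λ _ → c) xs) ≡ length xs * c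
  sum-map-const c [] = refl
  sum-map-const c (x ∷ xs) = cong (c +_) (sum-map-const c xs)

sum-tabulate-const : ∀ n c → sum (tabulate {n = n} (λ _ → c)) ≡ n * c
sum-tabulate-const zero c = refl
sum-tabulate-const (suc n) c = cong (c +_) (sum-tabulate-const n c)

sum-tabulate-0 : ∀ n → sum (tabulate {n = n} (λ _ → 0)) ≡ 0
sum-tabulate-0 n = trans (sum-tabulate-const n 0) (*-zeroʳ n)

sum-tabulate-𝟙[≟] : ∀ {n} (j : Fin n) → sum (tabulate (λ i → 𝟙[ j ≟F i ])) ≡ 1
sum-tabulate-𝟙[≟] {suc n} fzero = cong suc (sum-tabulate-0 n)
sum-tabulate-𝟙[≟] (fsuc j) = sum-tabulate-𝟙[≟] j

replicate-++-∷ : ∀ {a} {A : Set a} n (x : A) ys → replicate n x ++ x ∷ ys ≡ x ∷ replicate n x ++ ys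
replicate-++-∷ zero x ys = refl
replicate-++-∷ (suc n) x ys = cong (x ∷_) (replicate-++-∷ n x ys)

IsNu-¬∣ : ∀ {k x e} → ¬ k ∣ x → IsNu k x e → e ≡ 0
IsNu-¬∣ {e = zero} _ _ = refl
IsNu-¬∣ {k} {e = suc e} k∤x (k^[1+e]∣x , _) = contradiction (∣-trans (m∣m*n (k ^ e)) k^[1+e]∣x) k∤x

IsNu-*ˡ : ∀ {k x e} .{{_ : NonZero k}} → IsNu k (k * x) e → ∃[ e′ ] e ≡ suc e′ × IsNu k x e′
IsNu-*ˡ {k} {x} {zero} (_ , maximal) = contradiction (maximal 1 (*-monoʳ-∣ k (1∣ x))) λ ()
IsNu-*ˡ {k} {x} {suc e} (k^[1+e]∣kx , maximal) =
  e , refl , *-cancelˡ-∣ k k^[1+e]∣kx , λ e′ k^e′∣x → ≤-pred (maximal (suc e′) (*-monoʳ-∣ k k^e′∣x))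

module ChipFiring (k : ℕ) where

  count : Vertex k → List (Vertex k) → ℕ
  count x vs = sum (map (λ y → 𝟙[ x ≟V y ]) vs)

  count-++ : ∀ x vs ws → count x (vs ++ ws) ≡ count x vs + count x ws
  count-++ x vs ws = trans (cong sum (map-++ _ vs ws)) (sum-++ (map (λ y → 𝟙[ x ≟V y ]) vs) _)

  rootFires≡count : (vs : List (Vertex k)) → rootFires vs ≡ count [] vs
  rootFires≡count [] = refl
  rootFires≡count ([] ∷ vs) = cong suc (rootFires≡count vs)
  rootFires≡count ((_ ∷ _) ∷ vs) = rootFires≡count vs

  rootFires-++ : (vs ws : List (Vertex k)) → rootFires (vs ++ ws) ≡ rootFires vs + rootFires ws
  rootFires-++ [] ws = refl
  rootFires-++ ([] ∷ vs) ws = cong suc (rootFires-++ vs ws)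
  rootFires-++ ((_ ∷ _) ∷ vs) ws = rootFires-++ vs ws

  -- The self-loop makes the root its own upper neighbour.
  up : Vertex k → Vertex k
  up [] = []
  up (_ ∷ w) = w

  children : Vertex k → List (Vertex k)
  children w = tabulate (_∷ w)

  neighbours : Vertex k → List (Vertex k)
  neighbours w = up w ∷ children w

  received : Vertex k → List (Vertex k) → ℕ
  received x vs = sum (map (λ u → count u vs) (neighbours x))

  received-[] : ∀ x → received x [] ≡ 0
  received-[] x = trans (cong sum (map-tabulate (_∷ x) _)) (sum-tabulate-0 k)

  received-++ : ∀ x vs ws → received x (vs ++ ws) ≡ received x vs + received x ws
  received-++ x vs ws = trans (cong sum (map-cong (λ u → count-++ u vs ws) (neighbours x)))
                              (sum-map-+ (λ u → count u vs) (λ u → count u ws) (neighbours x))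

  received-mono-≤ : ∀ {vs ws} → (∀ y → count y vs ≤ count y ws) → ∀ x → received x vs ≤ received x ws
  received-mono-≤ vs≤ws x = sum-map-mono-≤ vs≤ws (neighbours x)

  isChildOf-∷ : ∀ (j : Fin k) q w → isChildOf (j ∷ q) w ≡ 𝟙[ q ≟V w ]
  isChildOf-∷ j q w with q ≟V w
  ... | yes _ = refl
  ... | no _ = refl

  count-children : ∀ (v w : Vertex k) → count v (children w) ≡ isChildOf v w
  count-children [] w = trans (cong sum (map-tabulate (_∷ w) _)) (sum-tabulate-0 k)
  count-children (j ∷ q) w =
    trans (cong sum (map-tabulate (_∷ w) _)) (trans (count-tabulate (q ≟V w)) (sym (isChildOf-∷ j q w)))
    where
    count-tabulate : (d : Dec (q ≡ w)) → sum (tabulate (λ i → 𝟙[ (j ∷ q) ≟V (i ∷ w) ])) ≡ 𝟙[ d ]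
    count-tabulate (yes refl) =
      trans (cong sum (tabulate-cong λ i → 𝟙-cong ∷-injectiveˡ (cong (_∷ q)) ((j ∷ q) ≟V (i ∷ q)) (j ≟F i)))
            (sum-tabulate-𝟙[≟] j)
    count-tabulate (no q≢w) =
      trans (cong sum (tabulate-cong λ i → 𝟙-no ((j ∷ q) ≟V (i ∷ w)) (q≢w ∘ ∷-injectiveʳ))) (sum-tabulate-0 k)

  count-neighbours-self : ∀ x → count x (neighbours x) ≡ selfLoop x
  count-neighbours-self [] = cong suc (count-children [] [])
  count-neighbours-self x@(j ∷ w) = cong₂ _+_ (𝟙-no (x ≟V w) (1+n≢n ∘ cong length)) (begin
    count x (children x)  ≡⟨ count-children x x ⟩
    isChildOf x x         ≡⟨ isChildOf-∷ j w x ⟩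
    𝟙[ w ≟V x ]           ≡⟨ 𝟙-no (w ≟V x) (1+n≢n ∘ cong length ∘ sym) ⟩
    0                     ∎)
    where open ≡-Reasoning

  isChildOf-up : ∀ {x v : Vertex k} → x ≢ v → isChildOf x v ≡ 𝟙[ v ≟V up x ]
  isChildOf-up {[]} {v} x≢v = sym (𝟙-no (v ≟V []) (x≢v ∘ sym))
  isChildOf-up {j ∷ w} {v} _ = trans (isChildOf-∷ j w v) (𝟙-cong sym sym (w ≟V v) (v ≟V w))

  fire-balance : ∀ {v c} → suc k ≤ c v → ∀ x →
                 fire k v c x + 𝟙[ x ≟V v ] * suc k ≡ c x + count v (neighbours x)
  fire-balance {v} {c} le x with x ≟V v
  ... | yes refl = begin
    c x ∸ suc k + selfLoop x + (suc k + 0)  ≡⟨ cong (c x ∸ suc k + selfLoop x +_) (+-identityʳ (suc k)) ⟩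
    c x ∸ suc k + selfLoop x + suc k        ≡⟨ xy∙z≈xz∙y +-commutativeSemigroup (c x ∸ suc k) _ _ ⟩
    c x ∸ suc k + suc k + selfLoop x        ≡⟨ cong (_+ selfLoop x) (m∸n+n≡m le) ⟩
    c x + selfLoop x                        ≡⟨ cong (c x +_) (count-neighbours-self x) ⟨
    c x + count x (neighbours x)            ∎
    where open ≡-Reasoning
  ... | no x≢v = begin
    c x + isChildOf x v + isChildOf v x + 0  ≡⟨ +-identityʳ _ ⟩
    c x + isChildOf x v + isChildOf v x      ≡⟨ +-assoc (c x) _ _ ⟩
    c x + (isChildOf x v + isChildOf v x)    ≡⟨ cong (c x +_) (cong₂ _+_ (isChildOf-up x≢v) children-v) ⟩
    c x + count v (neighbours x)             ∎
    where
    open ≡-Reasoning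
    children-v : isChildOf v x ≡ count v (children x)
    children-v = sym (count-children v x)

  fire-mono : ∀ {v x} c → x ≢ v → c x ≤ fire k v c x
  fire-mono {v} {x} c x≢v with x ≟V v
  ... | yes x≡v = contradiction x≡v x≢v
  ... | no _ = ≤-trans (m≤m+n (c x) _) (m≤m+n _ _)

  -- d arises from c by firing the multiset vs, legally or not.
  ChipBalance : Config k → List (Vertex k) → Config k → Set
  ChipBalance c vs d = ∀ x → d x + count x vs * suc k ≡ c x + received x vs

  ChipBalance-[] : ∀ {c} → ChipBalance c [] c
  ChipBalance-[] {c} x = cong (c x +_) (sym (received-[] x))

  ChipBalance-++ : ∀ {c d e vs ws} → ChipBalance c vs d → ChipBalance d ws e → ChipBalance c (vs ++ ws) e
  ChipBalance-++ {c} {d} {e} {vs} {ws} c→d d→e x = begin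
    e x + count x (vs ++ ws) * suc k       ≡⟨ cong (λ n → e x + n * suc k) (count-++ x vs ws) ⟩
    e x + (V + W) * suc k                  ≡⟨ cong (e x +_) (*-distribʳ-+ (suc k) V W) ⟩
    e x + (V * suc k + W * suc k)          ≡⟨ cong (e x +_) (+-comm (V * suc k) _) ⟩
    e x + (W * suc k + V * suc k)          ≡⟨ +-assoc (e x) _ _ ⟨
    e x + W * suc k + V * suc k            ≡⟨ cong (_+ V * suc k) (d→e x) ⟩
    d x + received x ws + V * suc k        ≡⟨ xy∙z≈xz∙y +-commutativeSemigroup (d x) _ _ ⟩
    d x + V * suc k + received x ws        ≡⟨ cong (_+ received x ws) (c→d x) ⟩
    c x + received x vs + received x ws    ≡⟨ +-assoc (c x) _ _ ⟩
    c x + (received x vs + received x ws)  ≡⟨ cong (c x +_) (received-++ x vs ws) ⟨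
    c x + received x (vs ++ ws)            ∎
    where
    open ≡-Reasoning
    V = count x vs
    W = count x ws

  fire-ChipBalance : ∀ {v c} → suc k ≤ c v → ChipBalance c [ v ] (fire k v c)
  fire-ChipBalance {v} {c} le x = begin
    fire k v c x + (𝟙[ x ≟V v ] + 0) * suc k  ≡⟨ cong (λ n → fire k v c x + n * suc k) (+-identityʳ 𝟙[ x ≟V v ]) ⟩
    fire k v c x + 𝟙[ x ≟V v ] * suc k        ≡⟨ fire-balance le x ⟩
    c x + count v (neighbours x)              ≡⟨ cong (c x +_) (cong sum (map-cong single (neighbours x))) ⟩
    c x + received x [ v ]                    ∎
    where
    open ≡-Reasoning
    single : ∀ u → 𝟙[ v ≟V u ] ≡ 𝟙[ u ≟V v ] + 0
    single u = trans (𝟙-cong sym sym (v ≟V u) (u ≟V v)) (sym (+-identityʳ _))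

  Run⇒ChipBalance : ∀ {c vs d} → Run k c vs d → ChipBalance c vs d
  Run⇒ChipBalance done = ChipBalance-[]
  Run⇒ChipBalance {c} {v ∷ vs} {d} (step le run) =
    ChipBalance-++ {c} {fire k v c} {d} {[ v ]} {vs} (fire-ChipBalance le) (Run⇒ChipBalance run)

  Run-++ : ∀ {c vs d ws e} → Run k c vs d → Run k d ws e → Run k c (vs ++ ws) e
  Run-++ done run′ = run′
  Run-++ (step le run) run′ = step le (Run-++ run run′)

  count-snoc : ∀ y vs v → count y (vs ++ [ v ]) ≡ count y vs + 𝟙[ y ≟V v ]
  count-snoc y vs v = trans (count-++ y vs [ v ]) (cong (count y vs +_) (+-identityʳ _))

  module _ {c β cβ} (runβ : Run k c β cβ) (stableβ : Stable k cβ) where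

    -- If v had already fired in vs as often as in β, it would now hold at most as many chips
    -- as at the stable end of β, having received no more than there.
    count-<-stabilizing : ∀ {vs d v} → ChipBalance c vs d → (∀ y → count y vs ≤ count y β) →
                          suc k ≤ d v → count v vs < count v β
    count-<-stabilizing {vs} {d} {v} c→d vs≤β loaded with count v vs <? count v β
    ... | yes lt = lt
    ... | no ¬lt = contradiction (≤-trans loaded d≤cβ) (<⇒≱ (stableβ v))
      where
      d≤cβ : d v ≤ cβ v
      d≤cβ = +-cancelʳ-≤ (count v β * suc k) (d v) (cβ v) (begin
        d v + count v β * suc k    ≡⟨ cong (λ n → d v + n * suc k) (≤-antisym (≮⇒≥ ¬lt) (vs≤β v)) ⟩
        d v + count v vs * suc k   ≡⟨ c→d v ⟩
        c v + received v vs        ≤⟨ +-monoʳ-≤ (c v) (received-mono-≤ {vs} {β} vs≤β v) ⟩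
        c v + received v β         ≡⟨ Run⇒ChipBalance runβ v ⟨
        cβ v + count v β * suc k   ∎)
        where open ≤-Reasoning

    least-action′ : ∀ {vs d α d′} → ChipBalance c vs d → (∀ y → count y vs ≤ count y β) →
                    Run k d α d′ → ∀ y → count y (vs ++ α) ≤ count y β
    least-action′ {vs} c→d vs≤β done y =
      subst (λ ws → count y ws ≤ count y β) (sym (++-identityʳ vs)) (vs≤β y)
    least-action′ {vs} {d} {v ∷ α} c→d vs≤β (step loaded run) y =
      subst (λ ws → count y ws ≤ count y β) (++-assoc vs [ v ] α)
            (least-action′ {vs ++ [ v ]} c→d′ vs+v≤β run y)
      where
      c→d′ : ChipBalance c (vs ++ [ v ]) (fire k v d)
      c→d′ = ChipBalance-++ {c} {d} {fire k v d} {vs} {[ v ]} c→d (fire-ChipBalance loaded)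

      vs+v≤β : ∀ y → count y (vs ++ [ v ]) ≤ count y β
      vs+v≤β y rewrite count-snoc y vs v with y ≟V v
      ... | yes refl =
        subst (_≤ count v β) (+-comm 1 (count v vs)) (count-<-stabilizing {vs} {d} {v} c→d vs≤β loaded)
      ... | no _ = subst (_≤ count y β) (sym (+-identityʳ (count y vs))) (vs≤β y)

  least-action : ∀ {c α cα β cβ} → Run k c α cα → Run k c β cβ → Stable k cβ → ∀ y → count y α ≤ count y β
  least-action runα runβ stableβ = least-action′ runβ stableβ {vs = []} ChipBalance-[] (λ _ → z≤n) runα

  rootFires-unique : ∀ {c α β} → Stabilizing k c α → Stabilizing k c β → rootFires α ≡ rootFires β
  rootFires-unique {α = α} {β} (_ , runα , stableα) (_ , runβ , stableβ) = begin
    rootFires α  ≡⟨ rootFires≡count α ⟩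
    count [] α   ≡⟨ ≤-antisym (least-action runα runβ stableβ []) (least-action runβ runα stableα []) ⟩
    count [] β   ≡⟨ rootFires≡count β ⟨
    rootFires β  ∎
    where open ≡-Reasoning

  run-of-distinct : ∀ vs c → (∀ x → count x vs ≤ 1) → (∀ x → 1 ≤ count x vs → suc k ≤ c x) →
                    ∃[ c′ ] Run k c vs c′
  run-of-distinct [] c _ _ = c , done
  run-of-distinct (v ∷ vs) c distinct loaded =
    let c′ , run = run-of-distinct vs (fire k v c) distinct′ loaded′ in c′ , step loaded-v run
    where
    loaded-v : suc k ≤ c v
    loaded-v = loaded v (≤-trans (≤-reflexive (sym (𝟙-yes (v ≟V v) refl))) (m≤m+n _ _))
    distinct′ : ∀ x → count x vs ≤ 1
    distinct′ x = ≤-trans (m≤n+m _ _) (distinct x)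
    loaded′ : ∀ x → 1 ≤ count x vs → suc k ≤ fire k v c x
    loaded′ x 1≤count = ≤-trans (loaded x (≤-trans 1≤count (m≤n+m _ _))) (fire-mono c x≢v)
      where
      x≢v : x ≢ v
      x≢v refl = <⇒≱ (+-monoʳ-≤ 1 1≤count) (subst (λ n → n + count x vs ≤ 1) (𝟙-yes (x ≟V x) refl) (distinct x))

  level : ℕ → List (Vertex k)
  level zero = [ [] ]
  level (suc i) = concatMap children (level i)

  count-concatMap : ∀ x (f : Vertex k → List (Vertex k)) vs →
                    count x (concatMap f vs) ≡ sum (map (count x ∘ f) vs)
  count-concatMap x f [] = refl
  count-concatMap x f (v ∷ vs) =
    trans (count-++ x (f v) (concatMap f vs)) (cong (count x (f v) +_) (count-concatMap x f vs))

  count-level : ∀ i x → count x (level i) ≡ 𝟙[ length x ≟ i ]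
  count-level zero [] = refl
  count-level zero (_ ∷ _) = refl
  count-level (suc i) x = trans (count-concatMap x children (level i))
                                (trans (cong sum (map-cong (count-children x) (level i))) (count-parents x))
    where
    count-parents : ∀ x → sum (map (isChildOf x) (level i)) ≡ 𝟙[ length x ≟ suc i ]
    count-parents [] = trans (sum-map-const 0 (level i)) (*-zeroʳ (length (level i)))
    count-parents (j ∷ q) = trans (cong sum (map-cong (isChildOf-∷ j q) (level i))) (count-level i q)

  rootFires-level : ∀ i → rootFires (level i) ≡ 𝟙[ i ≟ 0 ]
  rootFires-level zero = refl
  rootFires-level (suc i) = trans (rootFires≡count (level (suc i))) (count-level (suc i) [])

  length-up : ∀ x → length (up x) ≡ pred (length x)
  length-up [] = refl
  length-up (_ ∷ _) = refl

  -- Inflow at depth d when level i fires; pred 0 = 0 accounts for the root's self-loop.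
  levelInflow : ℕ → ℕ → ℕ
  levelInflow i d = 𝟙[ pred d ≟ i ] + 𝟙[ suc d ≟ i ] * k

  received-level : ∀ i x → received x (level i) ≡ levelInflow i (length x)
  received-level i x = cong₂ _+_ (trans (count-level i (up x)) (cong (λ n → 𝟙[ n ≟ i ]) (length-up x))) (begin
    sum (map (λ u → count u (level i)) (children x))  ≡⟨ cong sum (map-tabulate (_∷ x) _) ⟩
    sum (tabulate (λ j → count (j ∷ x) (level i)))    ≡⟨ cong sum (tabulate-cong (count-level i ∘ (_∷ x))) ⟩
    sum (tabulate {n = k} (λ _ → 𝟙[ suc (length x) ≟ i ]))  ≡⟨ sum-tabulate-const k _ ⟩
    k * 𝟙[ suc (length x) ≟ i ]                       ≡⟨ *-comm k _ ⟩
    𝟙[ suc (length x) ≟ i ] * k                       ∎)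
    where open ≡-Reasoning

  Profile : Set
  Profile = List ℕ

  at : Profile → ℕ → ℕ
  at [] _ = 0
  at (a ∷ l) zero = a
  at (a ∷ l) (suc d) = at l d

  _HasProfile_ : Config k → Profile → Set
  c HasProfile l = ∀ x → c x ≡ at l (length x)

  initial-HasProfile : ∀ N → initial k N HasProfile (N ∷ [])
  initial-HasProfile N [] = refl
  initial-HasProfile N (_ ∷ _) = refl

  at-≤ : ∀ {b l} → All (_≤ b) l → ∀ d → at l d ≤ b
  at-≤ [] d = z≤n
  at-≤ (a≤b ∷ _) zero = a≤b
  at-≤ (_ ∷ l≤b) (suc d) = at-≤ l≤b d

  HasProfile⇒Stable : ∀ {c l} → All (_≤ k) l → c HasProfile l → Stable k c
  HasProfile⇒Stable l≤k profile x = s≤s (subst (_≤ k) (sym (profile x)) (at-≤ l≤k (length x)))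

  addHead : ℕ → Profile → Profile
  addHead c [] = c ∷ []
  addHead c (a ∷ l) = c + a ∷ l

  at-addHead-1 : ∀ l d → at (addHead 1 l) d ≡ at l d + 𝟙[ d ≟ 0 ]
  at-addHead-1 [] zero = refl
  at-addHead-1 [] (suc d) = refl
  at-addHead-1 (a ∷ l) zero = +-comm 1 a
  at-addHead-1 (a ∷ l) (suc d) = sym (+-identityʳ (at l d))

  at-addHead-≥ : ∀ c l d → at l d ≤ at (addHead c l) d
  at-addHead-≥ c [] d = z≤n
  at-addHead-≥ c (a ∷ l) zero = m≤n+m a c
  at-addHead-≥ c (a ∷ l) (suc d) = ≤-refl

  -- Junk unless level i is loaded. A root firing loses only k chips: one returns along the self-loop.
  fireLevel : ℕ → Profile → Profile
  fireLevel zero [] = []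
  fireLevel zero (a ∷ l) = a ∸ k ∷ addHead 1 l
  fireLevel (suc zero) [] = []
  fireLevel (suc zero) (a ∷ []) = a ∷ []
  fireLevel (suc zero) (a ∷ b ∷ l) = a + k ∷ b ∸ suc k ∷ addHead 1 l
  fireLevel (suc (suc i)) [] = []
  fireLevel (suc (suc i)) (a ∷ l) = a ∷ fireLevel (suc i) l

  fireLevel-at : ∀ i l → suc k ≤ at l i → ∀ d →
                 at (fireLevel i l) d + 𝟙[ d ≟ i ] * suc k ≡ at l d + levelInflow i d
  fireLevel-at zero (a ∷ l) loaded zero = begin
    a ∸ k + (suc k + 0)  ≡⟨ cong (a ∸ k +_) (+-identityʳ (suc k)) ⟩
    a ∸ k + suc k        ≡⟨ +-suc (a ∸ k) k ⟩
    suc (a ∸ k + k)      ≡⟨ cong suc (m∸n+n≡m (<⇒≤ loaded)) ⟩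
    suc a                ≡⟨ +-comm 1 a ⟩
    a + 1                ∎
    where open ≡-Reasoning
  fireLevel-at zero (a ∷ l) _ (suc d) = trans (cong (_+ 0) (at-addHead-1 l d)) (+-assoc (at l d) _ 0)
  fireLevel-at (suc zero) (a ∷ b ∷ l) _ zero = +-assoc a k 0
  fireLevel-at (suc zero) (a ∷ b ∷ l) loaded (suc zero) =
    trans (sym (+-assoc (b ∸ suc k) (suc k) 0)) (cong (_+ 0) (m∸n+n≡m loaded))
  fireLevel-at (suc zero) (a ∷ b ∷ l) _ (suc (suc d)) =
    trans (cong (_+ 0) (at-addHead-1 l d)) (+-assoc (at l d) _ 0)
  fireLevel-at (suc (suc i)) (a ∷ l) _ zero = refl
  fireLevel-at (suc (suc i)) (a ∷ l) loaded (suc zero) = fireLevel-at (suc i) l loaded zero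
  fireLevel-at (suc (suc i)) (a ∷ l) loaded (suc (suc d)) = fireLevel-at (suc i) l loaded (suc d)

  fireLevel-run : ∀ {c l} i → c HasProfile l → suc k ≤ at l i →
                  ∃[ c′ ] Run k c (level i) c′ × c′ HasProfile fireLevel i l
  fireLevel-run {c} {l} i profile loaded =
    let c′ , run = run-of-distinct (level i) c distinct loaded-level in c′ , run , profile′ run
    where
    distinct : ∀ x → count x (level i) ≤ 1
    distinct x = subst (_≤ 1) (sym (count-level i x)) (𝟙≤1 (length x ≟ i))

    loaded-level : ∀ x → 1 ≤ count x (level i) → suc k ≤ c x
    loaded-level x 1≤count = subst (suc k ≤_) (sym (trans (profile x) (cong (at l) depth≡i))) loaded
      where
      depth≡i : length x ≡ i
      depth≡i = 𝟙-sound (length x ≟ i) (subst (1 ≤_) (count-level i x) 1≤count)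

    profile′ : ∀ {c′} → Run k c (level i) c′ → c′ HasProfile fireLevel i l
    profile′ {c′} run x = +-cancelʳ-≡ (𝟙[ length x ≟ i ] * suc k) _ _ (begin
      c′ x + 𝟙[ length x ≟ i ] * suc k                         ≡⟨ cong (λ n → c′ x + n * suc k) (count-level i x) ⟨
      c′ x + count x (level i) * suc k                         ≡⟨ Run⇒ChipBalance run x ⟩
      c x + received x (level i)                               ≡⟨ cong₂ _+_ (profile x) (received-level i x) ⟩
      at l (length x) + levelInflow i (length x)               ≡⟨ fireLevel-at i l loaded (length x) ⟨
      at (fireLevel i l) (length x) + 𝟙[ length x ≟ i ] * suc k ∎)
      where open ≡-Reasoning

  -- Runs firing whole levels; the ℕ index counts root firings.
  data ProfileRun : Profile → ℕ → Profile → Set where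
    done : ∀ {l} → ProfileRun l 0 l
    step : ∀ {l r l′} i → suc k ≤ at l i → ProfileRun (fireLevel i l) r l′ → ProfileRun l (𝟙[ i ≟ 0 ] + r) l′

  castProfileRun : ∀ {l₁ l₂ r l₁′ l₂′} → l₁ ≡ l₂ → l₁′ ≡ l₂′ → ProfileRun l₁ r l₁′ → ProfileRun l₂ r l₂′
  castProfileRun refl refl run = run

  _◅◅_ : ∀ {l r l′ s l″} → ProfileRun l r l′ → ProfileRun l′ s l″ → ProfileRun l (r + s) l″
  done ◅◅ run′ = run′
  _◅◅_ {l} {s = s} {l″} (step {r = r} i loaded run) run′ =
    subst (λ n → ProfileRun l n l″) (sym (+-assoc 𝟙[ i ≟ 0 ] r s)) (step i loaded (run ◅◅ run′))

  realise : ∀ {l r l′ c} → ProfileRun l r l′ → c HasProfile l →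
            ∃₂ λ vs c′ → Run k c vs c′ × c′ HasProfile l′ × rootFires vs ≡ r
  realise done profile = [] , _ , done , profile , refl
  realise (step {r = r} i loaded run) profile with fireLevel-run i profile loaded
  ... | _ , run₁ , profile₁ with realise run profile₁
  ... | vs , c′ , run₂ , profile′ , roots =
    level i ++ vs , c′ , Run-++ run₁ run₂ , profile′ , (begin
      rootFires (level i ++ vs)          ≡⟨ rootFires-++ (level i) vs ⟩
      rootFires (level i) + rootFires vs ≡⟨ cong₂ _+_ (rootFires-level i) roots ⟩
      𝟙[ i ≟ 0 ] + r                     ∎)
    where open ≡-Reasoning

  fireLevel-addHead : ∀ c i l → suc k ≤ at l i → fireLevel i (addHead c l) ≡ addHead c (fireLevel i l)
  fireLevel-addHead c zero (a ∷ l) loaded = cong (_∷ addHead 1 l) (+-∸-assoc c (<⇒≤ loaded))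
  fireLevel-addHead c (suc zero) (a ∷ b ∷ l) _ = cong (_∷ b ∸ suc k ∷ addHead 1 l) (+-assoc c a k)
  fireLevel-addHead c (suc (suc i)) (a ∷ l) _ = refl

  ProfileRun-addHead : ∀ c {l r l′} → ProfileRun l r l′ → ProfileRun (addHead c l) r (addHead c l′)
  ProfileRun-addHead c done = done
  ProfileRun-addHead c (step {l} i loaded run) =
    step i (≤-trans loaded (at-addHead-≥ c l i))
           (castProfileRun (sym (fireLevel-addHead c i l loaded)) refl (ProfileRun-addHead c run))

module Stabilization (K : ℕ) where

  k : ℕ
  k = suc K

  open ChipFiring k

  Digit : ℕ → Set
  Digit d = 1 ≤ d × d ≤ k

  top-digit : ∀ {d} → Digit d → ¬ d < k → d ≡ k
  top-digit (_ , d≤k) d≮k = ≤-antisym d≤k (≮⇒≥ d≮k)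

  -- Numerals in bijective base k (digits 1, …, k), least significant digit first.
  increment : List ℕ → List ℕ
  increment [] = 1 ∷ []
  increment (d ∷ D) with d <? k
  ... | yes _ = suc d ∷ D
  ... | no _ = 1 ∷ increment D

  carries : List ℕ → ℕ
  carries [] = 0
  carries (d ∷ D) with d <? k
  ... | yes _ = 0
  ... | no _ = suc (carries D)

  digits : ℕ → List ℕ
  digits zero = []
  digits (suc n) = increment (digits n)

  value : List ℕ → ℕ
  value [] = 0
  value (d ∷ D) = d + k * value D

  increment-Digit : ∀ D → All Digit D → All Digit (increment D)
  increment-Digit [] [] = (≤-refl , s≤s z≤n) ∷ []
  increment-Digit (d ∷ D) (_ ∷ D-digits) with d <? k
  ... | yes d<k = (s≤s z≤n , d<k) ∷ D-digits
  ... | no _ = (≤-refl , s≤s z≤n) ∷ increment-Digit D D-digits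

  digits-Digit : ∀ n → All Digit (digits n)
  digits-Digit zero = []
  digits-Digit (suc n) = increment-Digit (digits n) (digits-Digit n)

  value-increment : ∀ D → All Digit D → value (increment D) ≡ suc (value D)
  value-increment [] [] = cong suc (*-zeroʳ k)
  value-increment (d ∷ D) (digit ∷ D-digits) with d <? k
  ... | yes _ = refl
  ... | no d≮k with top-digit digit d≮k
  ... | refl = cong suc (trans (cong (k *_) (value-increment D D-digits)) (*-suc k (value D)))

  value-digits : ∀ n → value (digits n) ≡ n
  value-digits zero = refl
  value-digits (suc n) = trans (value-increment (digits n) (digits-Digit n)) (cong suc (value-digits n))

  k<k+k : k < k + k
  k<k+k = s≤s (m≤n+m k K)

  at-replicate : ∀ s x b Y → at (replicate s x ++ b ∷ Y) s ≡ b
  at-replicate zero x b Y = refl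
  at-replicate (suc s) x b Y = at-replicate s x b Y

  fireLevel-ones : ∀ s b Y → fireLevel (suc s) (1 ∷ replicate s 1 ++ b ∷ Y)
                             ≡ replicate s 1 ++ suc k ∷ b ∸ suc k ∷ addHead 1 Y
  fireLevel-ones zero b Y = refl
  fireLevel-ones (suc s) b Y = cong (1 ∷_) (fireLevel-ones s b Y)

  -- Fires the levels s + 1, s, …, 1, 0 once each.
  wave : ∀ s Y → ProfileRun (k ∷ replicate s 1 ++ suc k ∷ Y) 1 (k ∷ replicate (suc s) 1 ++ addHead 1 Y)
  wave zero Y = castProfileRun refl (cong₂ (λ a b → a ∷ suc b ∷ addHead 1 Y) (m+n∸n≡m k k) (n∸n≡0 k))
                               (step 1 ≤-refl (step 0 k<k+k done))
  wave (suc s) Y = step (suc (suc s)) (≤-reflexive (sym (at-replicate s 1 (suc k) Y)))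
    (castProfileRun (cong (k ∷_) (sym (fireLevel-ones s (suc k) Y))) tail-settles
                    (wave s (suc k ∸ suc k ∷ addHead 1 Y)))
    where
    tail-settles : k ∷ 1 ∷ replicate s 1 ++ suc (k ∸ k) ∷ addHead 1 Y
                 ≡ k ∷ 1 ∷ 1 ∷ replicate s 1 ++ addHead 1 Y
    tail-settles = cong (λ z → k ∷ 1 ∷ z) (trans (cong (λ c → replicate s 1 ++ suc c ∷ addHead 1 Y) (n∸n≡0 k))
                                                (replicate-++-∷ s 1 (addHead 1 Y)))

  carryRun : ∀ s D → All Digit D → ProfileRun (k ∷ replicate s 1 ++ suc k ∷ D)
                                               (suc (carries D))
                                               (k ∷ replicate (suc s) 1 ++ increment D)
  carryRun s [] [] = wave s []
  carryRun s (d ∷ D) (digit ∷ D-digits) with d <? k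
  ... | yes _ = wave s (d ∷ D)
  ... | no d≮k with top-digit digit d≮k
  ... | refl = wave s (k ∷ D) ◅◅ castProfileRun refl carry-settles (carryRun (suc s) D D-digits)
    where
    carry-settles : k ∷ replicate (suc (suc s)) 1 ++ increment D ≡ k ∷ replicate (suc s) 1 ++ 1 ∷ increment D
    carry-settles = cong (k ∷_) (sym (replicate-++-∷ (suc s) 1 (increment D)))

  cascade : ∀ D → All Digit D → ProfileRun (k + k ∷ D) (suc (carries D)) (k ∷ increment D)
  cascade D D-digits =
    step 0 k<k+k (castProfileRun (cong (_∷ addHead 1 D) (sym (m+n∸n≡m k k))) refl (afterRoot D D-digits))
    where
    afterRoot : ∀ D → All Digit D → ProfileRun (k ∷ addHead 1 D) (carries D) (k ∷ increment D)
    afterRoot [] [] = done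
    afterRoot (d ∷ D) (digit ∷ D-digits) with d <? k
    ... | yes _ = done
    ... | no d≮k with top-digit digit d≮k
    ... | refl = carryRun 0 D D-digits

  -- rootFirings n is the paper's g₀(n + 1, k).
  rootFirings : ℕ → ℕ
  rootFirings zero = 0
  rootFirings (suc n) = rootFirings n + suc (carries (digits n))

  stabilization : ∀ n → ProfileRun (suc n * k ∷ []) (rootFirings n) (k ∷ digits n)
  stabilization zero = castProfileRun (cong (_∷ []) (sym (+-identityʳ k))) refl done
  stabilization (suc n) = ProfileRun-addHead k (stabilization n) ◅◅ cascade (digits n) (digits-Digit n)

  rootFires-stabilizing : ∀ n {vs} → Stabilizing k (initial k (suc n * k)) vs → rootFires vs ≡ rootFirings n
  rootFires-stabilizing n stabilizing with realise (stabilization n) (initial-HasProfile (suc n * k))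
  ... | _ , c′ , run , profile , roots = trans (rootFires-unique stabilizing (c′ , run , stable)) roots
    where
    stable : Stable k c′
    stable = HasProfile⇒Stable (≤-refl ∷ All.map proj₂ (digits-Digit n)) profile

  rootFires-next : ∀ n {vs₁ vs₂} →
                   Stabilizing k (initial k (suc n * k)) vs₁ → Stabilizing k (initial k (suc (suc n) * k)) vs₂ →
                   rootFires vs₂ ≡ rootFires vs₁ + suc (carries (digits n))
  rootFires-next n stabilizing₁ stabilizing₂ =
    trans (rootFires-stabilizing (suc n) stabilizing₂)
          (cong (_+ suc (carries (digits n))) (sym (rootFires-stabilizing n stabilizing₁)))

  -- The quantity (k − 1)m + 1 of the theorem, for the numeral of m − 1.
  weight : List ℕ → ℕ
  weight D = K * suc (value D) + 1

  weight-[] : weight [] ≡ k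
  weight-[] = trans (cong (_+ 1) (*-identityʳ K)) (+-comm K 1)

  weight-top : ∀ D → weight (k ∷ D) ≡ k * weight D
  weight-top D = identity K (value D)
    where
    identity : ∀ K v → K * suc (suc K + suc K * v) + 1 ≡ suc K * (K * suc v + 1)
    identity = solve-∀

  weight-∷ : ∀ d D → weight (d ∷ D) + d ≡ k * (K * value D + d + 1)
  weight-∷ d D = identity K d (value D)
    where
    identity : ∀ K d v → K * suc (d + suc K * v) + 1 + d ≡ suc K * (K * v + d + 1)
    identity = solve-∀

  k∤weight : ∀ {d} D → Digit d → d < k → ¬ k ∣ weight (d ∷ D)
  k∤weight {d} D (1≤d , _) d<k k∣weight = <⇒≱ d<k (∣⇒≤ {{>-nonZero 1≤d}} k∣d)
    where
    k∣d : k ∣ d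
    k∣d = ∣m+n∣m⇒∣n (subst (k ∣_) (sym (weight-∷ d D)) (m∣m*n _)) k∣weight

  weight-digits : ∀ n → weight (digits n) ≡ K * suc n + 1
  weight-digits n = cong (λ v → K * suc v + 1) (value-digits n)

  weight-digits≡power : ∀ n j → weight (digits n) ≡ k ^ suc j ⇔ suc n * K ≡ k ^ suc j ∸ 1
  weight-digits≡power n j = mk⇔ to from
    where
    open ≡-Reasoning
    to : weight (digits n) ≡ k ^ suc j → suc n * K ≡ k ^ suc j ∸ 1
    to eq = begin
      suc n * K          ≡⟨ *-comm (suc n) K ⟩
      K * suc n          ≡⟨ m+n∸n≡m (K * suc n) 1 ⟨
      K * suc n + 1 ∸ 1  ≡⟨ cong (_∸ 1) (trans (sym (weight-digits n)) eq) ⟩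
      k ^ suc j ∸ 1      ∎
    from : suc n * K ≡ k ^ suc j ∸ 1 → weight (digits n) ≡ k ^ suc j
    from eq = begin
      weight (digits n)  ≡⟨ weight-digits n ⟩
      K * suc n + 1      ≡⟨ cong (_+ 1) (trans (*-comm K (suc n)) eq) ⟩
      k ^ suc j ∸ 1 + 1  ≡⟨ m∸n+n≡m (m^n>0 k (suc j)) ⟩
      k ^ suc j          ∎

  module _ .{{_ : NonZero K}} where

    weight≢1 : ∀ D → weight D ≢ 1
    weight≢1 D eq = ≢-nonZero⁻¹ K (m*n≡0⇒m≡0 K (suc (value D)) (+-cancelʳ-≡ 1 _ 0 eq))

    carries-power : ∀ D → All Digit D → ∀ n → weight D ≡ k ^ suc n → carries D ≡ n
    carries-power [] [] zero _ = refl
    carries-power [] [] (suc n) eq =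
      contradiction (suc-injective (m*n≡1⇒m≡1 k (k ^ n) (sym 1≡k^[1+n]))) (≢-nonZero⁻¹ K)
      where
      1≡k^[1+n] : 1 ≡ k ^ suc n
      1≡k^[1+n] = *-cancelˡ-≡ 1 _ k (trans (*-identityʳ k) (trans (sym weight-[]) eq))
    carries-power (d ∷ D) (digit ∷ D-digits) n eq with d <? k
    ... | yes d<k = contradiction (subst (k ∣_) (sym eq) (m∣m*n (k ^ n))) (k∤weight D digit d<k)
    ... | no d≮k with top-digit digit d≮k
    ... | refl = carries-top n (*-cancelˡ-≡ (weight D) (k ^ n) k (trans (sym (weight-top D)) eq))
      where
      carries-top : ∀ n → weight D ≡ k ^ n → suc (carries D) ≡ n
      carries-top zero eq′ = contradiction eq′ (weight≢1 D)
      carries-top (suc n) eq′ = cong suc (carries-power D D-digits n eq′)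

    carries-IsNu : ∀ D → All Digit D → (∀ n → weight D ≢ k ^ suc n) →
                   ∀ {e} → IsNu k (weight D) e → carries D ≡ e
    carries-IsNu [] [] notPower _ = contradiction (trans weight-[] (sym (*-identityʳ k))) (notPower 0)
    carries-IsNu (d ∷ D) (digit ∷ D-digits) notPower {e} ν with d <? k
    ... | yes d<k = sym (IsNu-¬∣ (k∤weight D digit d<k) ν)
    ... | no d≮k with top-digit digit d≮k
    ... | refl with IsNu-*ˡ (subst (λ x → IsNu k x e) (weight-top D) ν)
    ... | e′ , refl , ν′ = cong suc (carries-IsNu D D-digits notPower′ ν′)
      where
      notPower′ : ∀ n → weight D ≢ k ^ suc n
      notPower′ n eq = notPower (suc n) (trans (weight-top D) (cong (k *_) eq))

    carries-digits-power : ∀ n j → suc n * K ≡ k ^ suc j ∸ 1 → carries (digits n) ≡ j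
    carries-digits-power n j eq =
      carries-power (digits n) (digits-Digit n) j (Equivalence.from (weight-digits≡power n j) eq)

    carries-digits-IsNu : ∀ n → ¬ (Σ ℕ λ j → 1 ≤ j × suc n * K ≡ k ^ j ∸ 1) →
                          ∀ {e} → IsNu k (K * suc n + 1) e → carries (digits n) ≡ e
    carries-digits-IsNu n notPower {e} ν = carries-IsNu (digits n) (digits-Digit n)
      (λ j eq → notPower (suc j , s≤s z≤n , Equivalence.to (weight-digits≡power n j) eq))
      (subst (λ x → IsNu k x e) (sym (weight-digits n)) ν)

mainTheorem9 : (k : ℕ) → 2 ≤ k → (m : ℕ) → 1 ≤ m →
    (vs₁ vs₂ : List (Vertex k)) →
    Stabilizing k (initial k (m * k)) vs₁ →
    Stabilizing k (initial k ((m + 1) * k)) vs₂ →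
    ((n : ℕ) → 1 ≤ n → m * (k ∸ 1) ≡ k ^ n ∸ 1 →
       rootFires vs₂ ≡ rootFires vs₁ + n)
    ×
    (¬ (Σ ℕ λ n → 1 ≤ n × m * (k ∸ 1) ≡ k ^ n ∸ 1) →
       (e : ℕ) → IsNu k ((k ∸ 1) * m + 1) e →
       rootFires vs₂ ≡ rootFires vs₁ + (e + 1))
mainTheorem9 (suc (suc K)) (s≤s (s≤s z≤n)) (suc n) (s≤s z≤n) vs₁ vs₂ stabilizing₁ stabilizing₂ =
  power , nonPower
  where
  open Stabilization (suc K)

  difference : rootFires vs₂ ≡ rootFires vs₁ + suc (carries (digits n))
  difference = rootFires-next n stabilizing₁
    (subst (λ m → Stabilizing k (initial k (m * k)) vs₂) (+-comm (suc n) 1) stabilizing₂)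

  power : ∀ j → 1 ≤ j → suc n * suc K ≡ k ^ j ∸ 1 → rootFires vs₂ ≡ rootFires vs₁ + j
  power (suc j) _ eq = trans difference (cong (λ c → rootFires vs₁ + suc c) (carries-digits-power n j eq))

  nonPower : ¬ (Σ ℕ λ j → 1 ≤ j × suc n * suc K ≡ k ^ j ∸ 1) →
             ∀ e → IsNu k (suc K * suc n + 1) e → rootFires vs₂ ≡ rootFires vs₁ + (e + 1)
  nonPower notPower e ν = trans difference (cong (rootFires vs₁ +_) (begin
    suc (carries (digits n))  ≡⟨ cong suc (carries-digits-IsNu n notPower ν) ⟩
    suc e                     ≡⟨ +-comm 1 e ⟩
    e + 1                     ∎))
    where open ≡-Reasoning
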